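{- For $n\ge 0$ let $C_n(u,\alpha)=\sum_{i=0}^n\binom ni (\alpha)_i\,u^{n-i}$. Then, as formal power series in $x$ and $y$, \[\sum_{m,n\ge0} C_{2m+n}(u,\alpha)\frac{x^m}{m!}\frac{y^n}{n!}=e^{u^2x+uy}\sum_{k\ge0}\frac{(\alpha)_{2k}}{(1-2ux-y)^{2k+\alpha}}\frac{x^k}{k!}.\]
   Context: $(\alpha)_n=\alpha(\alpha+1)\cdots(\alpha+n-1)$ is the rising factorial with $(\alpha)_0=1$; $u$ and $\alpha$ are indeterminates (or complex parameters), and negative/real powers of $1-2ux-y$ denote formal binomial series. -}

module Defs where

open import Algebra.Bundles using (CommutativeRing)
open import Data.Nat using (ℕ; zero; suc; _∸_) renaming (_+_ to _+ℕ_; _*_ to _*ℕ_)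
open import Data.Nat.Combinatorics using (_C_)

-- Everything is over an arbitrary commutative ring R; u, α are arbitrary
-- elements of R (taking R = ℚ[u,α] recovers the indeterminate reading,
-- R = ℂ the complex-parameter reading).
module _ {c ℓ} (R : CommutativeRing c ℓ) where
  open CommutativeRing R

  fromℕ : ℕ → Carrier
  fromℕ zero    = 0#
  fromℕ (suc n) = 1# + fromℕ n

  pow : Carrier → ℕ → Carrier
  pow a zero    = 1#
  pow a (suc n) = pow a n * a

  rising : Carrier → ℕ → Carrier
  rising a zero    = 1#
  rising a (suc n) = rising a n * (a + fromℕ n)

  falling : Carrier → ℕ → Carrier
  falling a zero    = 1#
  falling a (suc n) = falling a n * (a - fromℕ n)

  sumTo : ℕ → (ℕ → Carrier) → Carrier
  sumTo zero    f = f 0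
  sumTo (suc n) f = sumTo n f + f (suc n)

  Cpoly : Carrier → Carrier → ℕ → Carrier
  Cpoly u α n = sumTo n (λ i → fromℕ (n C i) * rising α i * pow u (n ∸ i))

  -- formal power series in x, y: F m n is the coefficient of x^m y^n
  FPS2 : Set c
  FPS2 = ℕ → ℕ → Carrier

  oneS : FPS2
  oneS zero zero = 1#
  oneS _    _    = 0#

  _⊛_ : FPS2 → FPS2 → FPS2
  (f ⊛ g) m n = sumTo m (λ i → sumTo n (λ j → f i j * g (m ∸ i) (n ∸ j)))

  powS : FPS2 → ℕ → FPS2
  powS f zero    = oneS
  powS f (suc k) = powS f k ⊛ f

  scaleS : Carrier → FPS2 → FPS2
  scaleS a f m n = a * f m n

  linearS : Carrier → Carrier → FPS2
  linearS a b 1 0 = a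
  linearS a b 0 1 = b
  linearS a b _ _ = 0#

  -- Σ_{k ≥ 0} x^k G_k  (coefficient of x^m y^n is Σ_{k ≤ m} [x^(m-k) y^n] G_k)
  sumXk : (ℕ → FPS2) → FPS2
  sumXk G m n = sumTo m (λ k → G k (m ∸ k) n)

  -- Operations needing 1/j!. `inv n` is meant to be the inverse of n+1 in R
  -- (R a ℚ-algebra); the theorem assumes this.
  module _ (inv : ℕ → Carrier) where

    invFact : ℕ → Carrier
    invFact zero    = 1#
    invFact (suc n) = invFact n * inv n

    -- exp(f) = Σ_j f^j / j!  for f with zero constant term
    -- (only j ≤ m + n contribute to [x^m y^n])
    expS : FPS2 → FPS2
    expS f m n = sumTo (m +ℕ n) (λ j → invFact j * powS f j m n)

    -- formal binomial series (1 + h)^γ = Σ_j binom(γ, j) h^j for h with zero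
    -- constant term, binom(γ, j) = γ(γ-1)...(γ-j+1)/j!
    binomS : Carrier → FPS2 → FPS2
    binomS γ h m n = sumTo (m +ℕ n) (λ j → falling γ j * invFact j * powS h j m n)

    LHS : Carrier → Carrier → FPS2
    LHS u α m n = Cpoly u α (2 *ℕ m +ℕ n) * invFact m * invFact n

    RHS : Carrier → Carrier → FPS2
    RHS u α = expS (linearS (u * u) u)
              ⊛ sumXk (λ k → scaleS (rising α (2 *ℕ k) * invFact k)
                               (binomS (- (fromℕ (2 *ℕ k) + α))
                                       (linearS (- (fromℕ 2 * u)) (- 1#))))

{-# OPTIONS --safe #-}
module Submission where

-- Both sides are exponential generating functions in x and y.  Coefficientwise, the
-- Cauchy product of e.g.f.s is the binomial convolution of their coefficient arrays;
-- e^{u²x+uy} has e.g.f. coefficients u^{2i} u^j; and since (α)_{2k} (2k+α)_{l+q} =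
-- (α)_{2k+l+q}, the sum over k has e.g.f. coefficients Σ_{k+l=p} binom(p,k) (α)_{2k+l+q} (2u)^l.
-- What remains is an identity of binomial sums, which is umbral: for the shift S on
-- sequences, C_N(u,α) is the value at 0 of (u + S)^N applied to the sequence ((α)_i)_i,
-- and (u + S)^{2m+n} = (u + S)^n (u² + S(2u + S))^m expands by the binomial theorem for
-- commuting operators.

open import Defs
open import Algebra.Bundles using (CommutativeRing)
open import Data.Nat as ℕ using (ℕ; suc; zero; _≤_; _<_; z≤n; s≤s; _!; _∸_)
import Data.Nat.Properties as ℕₚ
open import Data.Nat.Combinatorics
  using (_C_; nCn≡1; k>n⇒nCk≡0; nCk+nC[k+1]≡[n+1]C[k+1]; nCk≡n!/k![n-k]!; k![n∸k]!∣n!)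
open import Data.Nat.DivMod using (m/n*n≡m)
open import Data.Nat.Tactic.RingSolver using (solve-∀)
open import Function using (_∘_; _∘′_)
open import Level using (_⊔_)
open import Relation.Binary.PropositionalEquality as ≡ using (_≡_)
import Algebra.Properties.CommutativeSemigroup as CommSemigroupProperties
import Algebra.Properties.Semiring.Exp as SemiringExp
import Algebra.Properties.CommutativeSemiring.Exp as CommSemiringExp
import Algebra.Properties.Semiring.Mult as SemiringMult
import Algebra.Properties.Ring as RingProperties
import Relation.Binary.Reasoning.Setoid as ≈-Reasoning

nCk*[k!*[n∸k]!]≡n! : ∀ {n k} → k ≤ n → (n C k) ℕ.* (k ! ℕ.* (n ∸ k) !) ≡ n !
nCk*[k!*[n∸k]!]≡n! {n} {k} k≤n =
  ≡.trans (≡.cong (ℕ._* (k ! ℕ.* (n ∸ k) !)) (nCk≡n!/k![n-k]! k≤n)) (m/n*n≡m (k![n∸k]!∣n! k≤n))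
  where
  instance
    k!*[n∸k]!≢0 : ℕ.NonZero (k ! ℕ.* (n ∸ k) !)
    k!*[n∸k]!≢0 = ℕₚ.m*n≢0 (k !) ((n ∸ k) !) {{ℕₚ._!≢0 k}} {{ℕₚ._!≢0 (n ∸ k)}}

module PowerSeries {c ℓ} (R : CommutativeRing c ℓ) where

  open CommutativeRing R
  open ≈-Reasoning setoid
  private
    module +-CS = CommSemigroupProperties +-commutativeSemigroup
    module Mult = SemiringMult semiring
    module Exp  = SemiringExp semiring
    module CExp = CommSemiringExp commutativeSemiring

  open +-CS using () renaming (interchange to +-interchange)
  open CommSemigroupProperties *-commutativeSemigroup
    using (x∙yz≈y∙xz; x∙yz≈y∙zx; x∙yz≈zx∙y) renaming (interchange to *-interchange)
  open RingProperties ring using (-1*x≈-x; -‿involutive; -‿+-comm)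
  open import Algebra.Solver.Ring.NaturalCoefficients.Default commutativeSemiring

  ∑≤ : ℕ → (ℕ → Carrier) → Carrier
  ∑≤ = sumTo R
  syntax ∑≤ n (λ i → f) = ∑[ i ≤ n ] f

  infixr 8 _^_
  _^_ : Carrier → ℕ → Carrier
  _^_ = pow R

  ∑-cong : ∀ n {f g : ℕ → Carrier} → (∀ {i} → i ≤ n → f i ≈ g i) →
           ∑[ i ≤ n ] f i ≈ ∑[ i ≤ n ] g i
  ∑-cong zero    f≈g = f≈g z≤n
  ∑-cong (suc n) f≈g = +-cong (∑-cong n (f≈g ∘ ℕₚ.m≤n⇒m≤1+n)) (f≈g ℕₚ.≤-refl)

  ∑-distrib-+ : ∀ n (f g : ℕ → Carrier) → ∑[ i ≤ n ] (f i + g i) ≈ ∑[ i ≤ n ] f i + ∑[ i ≤ n ] g i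
  ∑-distrib-+ zero    f g = refl
  ∑-distrib-+ (suc n) f g = trans (+-congʳ (∑-distrib-+ n f g)) (+-interchange _ _ _ _)

  *-distribˡ-∑ : ∀ n a (f : ℕ → Carrier) → a * ∑[ i ≤ n ] f i ≈ ∑[ i ≤ n ] (a * f i)
  *-distribˡ-∑ zero    a f = refl
  *-distribˡ-∑ (suc n) a f = trans (distribˡ a _ _) (+-congʳ (*-distribˡ-∑ n a f))

  ∑-comm : ∀ m n (f : ℕ → ℕ → Carrier) →
           ∑[ i ≤ m ] (∑[ j ≤ n ] f i j) ≈ ∑[ j ≤ n ] (∑[ i ≤ m ] f i j)
  ∑-comm zero    n f = refl
  ∑-comm (suc m) n f = trans (+-congʳ (∑-comm m n f)) (sym (∑-distrib-+ n _ _))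

  ∑-suc : ∀ n (f : ℕ → Carrier) → ∑[ i ≤ suc n ] f i ≈ f 0 + ∑[ i ≤ n ] f (suc i)
  ∑-suc zero    f = refl
  ∑-suc (suc n) f = trans (+-congʳ (∑-suc n f)) (+-assoc _ _ _)

  ∑-0 : ∀ n {f : ℕ → Carrier} → (∀ {i} → i ≤ n → f i ≈ 0#) → ∑[ i ≤ n ] f i ≈ 0#
  ∑-0 zero    f≈0 = f≈0 z≤n
  ∑-0 (suc n) f≈0 = trans (+-cong (∑-0 n (f≈0 ∘ ℕₚ.m≤n⇒m≤1+n)) (f≈0 ℕₚ.≤-refl)) (+-identityˡ 0#)

  ∑-last : ∀ n {f : ℕ → Carrier} → (∀ {i} → i < n → f i ≈ 0#) → ∑[ i ≤ n ] f i ≈ f n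
  ∑-last zero    _   = refl
  ∑-last (suc n) f≈0 = trans (+-congʳ (∑-0 n (f≈0 ∘ s≤s))) (+-identityˡ _)

  private
    i<n⇒1+n∸i≡2+[n∸1+i] : ∀ {i n} → i < n → suc n ∸ i ≡ suc (suc (n ∸ suc i))
    i<n⇒1+n∸i≡2+[n∸1+i] {zero}  {suc n} _         = ≡.refl
    i<n⇒1+n∸i≡2+[n∸1+i] {suc i} {suc n} (s≤s i<n) = i<n⇒1+n∸i≡2+[n∸1+i] i<n

  ∑-antidiagonal-≤1 : ∀ n (K : ℕ → ℕ → Carrier) → (∀ j r → K j (suc (suc r)) ≈ 0#) →
                      ∑[ j ≤ suc n ] K j (suc n ∸ j) ≈ K n 1 + K (suc n) 0
  ∑-antidiagonal-≤1 n K K≈0 = +-cong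
    (trans (∑-last n (λ {j} j<n →
              trans (reflexive (≡.cong (K j) (i<n⇒1+n∸i≡2+[n∸1+i] j<n))) (K≈0 j _)))
           (reflexive (≡.cong (K n) (ℕₚ.m+n∸n≡m 1 n))))
    (reflexive (≡.cong (K (suc n)) (ℕₚ.n∸n≡0 n)))

  fromℕ≈×1# : ∀ n → fromℕ R n ≈ n Mult.× 1#
  fromℕ≈×1# zero    = refl
  fromℕ≈×1# (suc n) = +-congˡ (fromℕ≈×1# n)

  fromℕ-homo-+ : ∀ m n → fromℕ R (m ℕ.+ n) ≈ fromℕ R m + fromℕ R n
  fromℕ-homo-+ m n = begin
    fromℕ R (m ℕ.+ n)          ≈⟨ fromℕ≈×1# (m ℕ.+ n) ⟩
    (m ℕ.+ n) Mult.× 1#        ≈⟨ Mult.×-homo-+ 1# m n ⟩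
    m Mult.× 1# + n Mult.× 1#  ≈⟨ +-cong (fromℕ≈×1# m) (fromℕ≈×1# n) ⟨
    fromℕ R m + fromℕ R n      ∎

  fromℕ-homo-* : ∀ m n → fromℕ R (m ℕ.* n) ≈ fromℕ R m * fromℕ R n
  fromℕ-homo-* m n = begin
    fromℕ R (m ℕ.* n)                ≈⟨ fromℕ≈×1# (m ℕ.* n) ⟩
    (m ℕ.* n) Mult.× 1#              ≈⟨ Mult.×1-homo-* m n ⟩
    (m Mult.× 1#) * (n Mult.× 1#)    ≈⟨ *-cong (fromℕ≈×1# m) (fromℕ≈×1# n) ⟨
    fromℕ R m * fromℕ R n            ∎

  ^≈Exp^ : ∀ x n → x ^ n ≈ x Exp.^ n
  ^≈Exp^ x zero    = refl
  ^≈Exp^ x (suc n) = trans (*-comm _ x) (*-congˡ (^≈Exp^ x n))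

  ^-homo-* : ∀ x m n → x ^ (m ℕ.+ n) ≈ x ^ m * x ^ n
  ^-homo-* x m n = begin
    x ^ (m ℕ.+ n)          ≈⟨ ^≈Exp^ x (m ℕ.+ n) ⟩
    x Exp.^ (m ℕ.+ n)      ≈⟨ Exp.^-homo-* x m n ⟩
    x Exp.^ m * x Exp.^ n  ≈⟨ *-cong (^≈Exp^ x m) (^≈Exp^ x n) ⟨
    x ^ m * x ^ n          ∎

  -‿^ : ∀ x n → (- x) ^ n ≈ (- 1#) ^ n * x ^ n
  -‿^ x n = begin
    (- x) ^ n                      ≈⟨ ^≈Exp^ (- x) n ⟩
    (- x) Exp.^ n                  ≈⟨ Exp.^-congˡ n (-1*x≈-x x) ⟨
    (- 1# * x) Exp.^ n             ≈⟨ CExp.^-distrib-* (- 1#) x n ⟩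
    (- 1#) Exp.^ n * x Exp.^ n     ≈⟨ *-cong (^≈Exp^ (- 1#) n) (^≈Exp^ x n) ⟨
    (- 1#) ^ n * x ^ n             ∎

  falling-neg : ∀ x n → falling R (- x) n * (- 1#) ^ n ≈ rising R x n
  falling-neg x zero    = *-identityˡ 1#
  falling-neg x (suc n) = begin
    falling R (- x) n * (- x - fromℕ R n) * ((- 1#) ^ n * - 1#)
      ≈⟨ *-interchange _ _ _ _ ⟩
    falling R (- x) n * (- 1#) ^ n * ((- x - fromℕ R n) * - 1#)
      ≈⟨ *-cong (falling-neg x n) (*-congʳ (-‿+-comm x (fromℕ R n))) ⟩
    rising R x n * (- (x + fromℕ R n) * - 1#)
      ≈⟨ *-congˡ (trans (*-comm _ _) (trans (-1*x≈-x _) (-‿involutive _))) ⟩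
    rising R x n * (x + fromℕ R n) ∎

  rising-+ : ∀ x m n → rising R x m * rising R (fromℕ R m + x) n ≈ rising R x (m ℕ.+ n)
  rising-+ x m zero    = trans (*-identityʳ _) (reflexive (≡.cong (rising R x) (≡.sym (ℕₚ.+-identityʳ m))))
  rising-+ x m (suc n) = begin
    rising R x m * (rising R (fromℕ R m + x) n * (fromℕ R m + x + fromℕ R n))
      ≈⟨ *-assoc _ _ _ ⟨
    rising R x m * rising R (fromℕ R m + x) n * (fromℕ R m + x + fromℕ R n)
      ≈⟨ *-cong (rising-+ x m n)
                (trans (+-congʳ (+-comm _ x)) (trans (+-assoc _ _ _) (+-congˡ (sym (fromℕ-homo-+ m n))))) ⟩
    rising R x (m ℕ.+ n) * (x + fromℕ R (m ℕ.+ n))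
      ≡⟨ ≡.cong (rising R x) (ℕₚ.+-suc m n) ⟨
    rising R x (m ℕ.+ suc n) ∎

  fromℕ-pascal : ∀ n k → fromℕ R (suc n C suc k) ≈ fromℕ R (n C k) + fromℕ R (n C suc k)
  fromℕ-pascal n k = trans (reflexive (≡.cong (fromℕ R) (≡.sym (nCk+nC[k+1]≡[n+1]C[k+1] n k))))
                          (fromℕ-homo-+ (n C k) (n C suc k))

  -- Opaque, so that unification meets binomialSum N h itself and can infer h.
  opaque
    binomialSum : ℕ → (ℕ → ℕ → Carrier) → Carrier
    binomialSum N h = ∑[ i ≤ N ] (fromℕ R (N C i) * h i (N ∸ i))

    binomialSum-cong : ∀ N {h h′ : ℕ → ℕ → Carrier} → (∀ {i} → i ≤ N → h i (N ∸ i) ≈ h′ i (N ∸ i)) →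
                       binomialSum N h ≈ binomialSum N h′
    binomialSum-cong N h≈h′ = ∑-cong N (λ i≤N → *-congˡ (h≈h′ i≤N))

    binomialSum-zero : ∀ h → binomialSum 0 h ≈ h 0 0
    binomialSum-zero h = trans (*-congʳ (+-identityʳ 1#)) (*-identityˡ _)

    *-distribˡ-binomialSum : ∀ N a h → a * binomialSum N h ≈ binomialSum N (λ i j → a * h i j)
    *-distribˡ-binomialSum N a h = trans (*-distribˡ-∑ N a _) (∑-cong N (λ _ → x∙yz≈y∙xz _ _ _))

    binomialSum-pascal : ∀ N h → binomialSum (suc N) h ≈
                         binomialSum N (λ i j → h (suc i) j) + binomialSum N (λ i j → h i (suc j))
    binomialSum-pascal N h = begin
      binomialSum (suc N) h
        ≈⟨ ∑-suc N _ ⟩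
      h₀ + ∑[ i ≤ N ] (fromℕ R (suc N C suc i) * h (suc i) (N ∸ i))
        ≈⟨ +-congˡ (trans (∑-cong N (λ _ → trans (*-congʳ (fromℕ-pascal N _)) (distribʳ _ _ _)))
                          (∑-distrib-+ N _ _)) ⟩
      h₀ + (binomialSum N (λ i j → h (suc i) j) + ∑[ i ≤ N ] (fromℕ R (N C suc i) * h (suc i) (N ∸ i)))
        ≈⟨ +-CS.x∙yz≈y∙xz _ _ _ ⟩
      binomialSum N (λ i j → h (suc i) j) + (h₀ + ∑[ i ≤ N ] (fromℕ R (N C suc i) * h (suc i) (N ∸ i)))
        ≈⟨ +-congˡ (sym (∑-suc N (λ i → fromℕ R (N C i) * h i (suc N ∸ i)))) ⟩
      binomialSum N (λ i j → h (suc i) j) + ∑[ i ≤ suc N ] (fromℕ R (N C i) * h i (suc N ∸ i))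
        ≈⟨ +-congˡ (+-cong
             (∑-cong N (λ {i} i≤N → *-congˡ (reflexive (≡.cong (h i) (ℕₚ.+-∸-assoc 1 i≤N)))))
             (trans (*-congʳ (reflexive (≡.cong (fromℕ R) (k>n⇒nCk≡0 (ℕₚ.n<1+n N))))) (zeroˡ _))) ⟩
      binomialSum N (λ i j → h (suc i) j) + (binomialSum N (λ i j → h i (suc j)) + 0#)
        ≈⟨ +-congˡ (+-identityʳ _) ⟩
      binomialSum N (λ i j → h (suc i) j) + binomialSum N (λ i j → h i (suc j)) ∎
      where
      h₀ : Carrier
      h₀ = fromℕ R (suc N C 0) * h 0 (suc N)

    binomialSum-comm : ∀ m n (h : ℕ → ℕ → ℕ → ℕ → Carrier) →
                       binomialSum m (λ i i′ → binomialSum n (λ j j′ → h i i′ j j′)) ≈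
                       binomialSum n (λ j j′ → binomialSum m (λ i i′ → h i i′ j j′))
    binomialSum-comm m n h = begin
      ∑[ i ≤ m ] (fromℕ R (m C i) * ∑[ j ≤ n ] (fromℕ R (n C j) * H i j))
        ≈⟨ ∑-cong m (λ _ → *-distribˡ-∑ n _ _) ⟩
      ∑[ i ≤ m ] (∑[ j ≤ n ] (fromℕ R (m C i) * (fromℕ R (n C j) * H i j)))
        ≈⟨ ∑-comm m n _ ⟩
      ∑[ j ≤ n ] (∑[ i ≤ m ] (fromℕ R (m C i) * (fromℕ R (n C j) * H i j)))
        ≈⟨ ∑-cong n (λ _ → trans (∑-cong m (λ _ → x∙yz≈y∙xz _ _ _)) (sym (*-distribˡ-∑ m _ _))) ⟩
      ∑[ j ≤ n ] (fromℕ R (n C j) * ∑[ i ≤ m ] (fromℕ R (m C i) * H i j)) ∎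
      where
      H : ℕ → ℕ → Carrier
      H i j = h i (m ∸ i) j (n ∸ j)

  binomialSum-flip : ∀ N h → binomialSum N h ≈ binomialSum N (λ i j → h j i)
  binomialSum-flip zero    h = trans (binomialSum-zero h) (sym (binomialSum-zero (λ i j → h j i)))
  binomialSum-flip (suc N) h = begin
    binomialSum (suc N) h
      ≈⟨ binomialSum-pascal N h ⟩
    binomialSum N (λ i j → h (suc i) j) + binomialSum N (λ i j → h i (suc j))
      ≈⟨ +-comm _ _ ⟩
    binomialSum N (λ i j → h i (suc j)) + binomialSum N (λ i j → h (suc i) j)
      ≈⟨ +-cong (binomialSum-flip N (λ i j → h i (suc j))) (binomialSum-flip N (λ i j → h (suc i) j)) ⟩
    binomialSum N (λ i j → h j (suc i)) + binomialSum N (λ i j → h (suc j) i)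
      ≈⟨ binomialSum-pascal N (λ i j → h j i) ⟨
    binomialSum (suc N) (λ i j → h j i) ∎

  Seq : Set c
  Seq = ℕ → Carrier

  infix 4 _≐_
  _≐_ : Seq → Seq → Set ℓ
  f ≐ g = ∀ t → f t ≈ g t

  open import Function.Endo.Propositional Seq using (Endo; ∘-id-monoid) renaming (_^_ to _^ᵒ_; ^-homo to ^ᵒ-homo)
  open import Algebra.Properties.Monoid.Mult ∘-id-monoid using () renaming (×-assocˡ to ^ᵒ-assoc)

  record IsLinear (B : Endo) : Set (c ⊔ ℓ) where
    field
      cong   : ∀ {f g} → f ≐ g → B f ≐ B g
      +-homo : ∀ f g → B (λ t → f t + g t) ≐ λ t → B f t + B g t
      *-homo : ∀ a f → B (λ t → a * f t) ≐ λ t → a * B f t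

    *-homoʳ : ∀ a f → B (λ t → f t * a) ≐ λ t → B f t * a
    *-homoʳ a f t = trans (cong (λ t → *-comm (f t) a) t) (trans (*-homo a f t) (*-comm a _))

    ∑-homo : ∀ n (F : ℕ → Seq) → B (λ t → ∑[ i ≤ n ] F i t) ≐ λ t → ∑[ i ≤ n ] B (F i) t
    ∑-homo zero    F t = refl
    ∑-homo (suc n) F t = trans (+-homo _ (F (suc n)) t) (+-congʳ (∑-homo n F t))

  shift : Endo
  shift f t = f (suc t)

  infixr 6 _+ᵒ_
  _+ᵒ_ : Carrier → Endo → Endo
  (a +ᵒ B) f t = a * f t + B f t

  shift-isLinear : IsLinear shift
  shift-isLinear = record
    { cong   = λ f≐g t → f≐g (suc t)
    ; +-homo = λ _ _ _ → refl
    ; *-homo = λ _ _ _ → refl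
    }

  +ᵒ-isLinear : ∀ a {B} → IsLinear B → IsLinear (a +ᵒ B)
  +ᵒ-isLinear a {B} B-lin = record
    { cong   = λ f≐g t → +-cong (*-congˡ (f≐g t)) (B.cong f≐g t)
    ; +-homo = λ f g t → trans (+-cong (distribˡ a (f t) (g t)) (B.+-homo f g t)) (+-interchange _ _ _ _)
    ; *-homo = λ b f t → trans (+-cong (x∙yz≈y∙xz a b (f t)) (B.*-homo b f t)) (sym (distribˡ b _ _))
    }
    where module B = IsLinear B-lin

  ∘-isLinear : ∀ {B C} → IsLinear B → IsLinear C → IsLinear (B ∘′ C)
  ∘-isLinear {B} {C} B-lin C-lin = record
    { cong   = λ f≐g → B.cong (C.cong f≐g)
    ; +-homo = λ f g t → trans (B.cong (C.+-homo f g) t) (B.+-homo (C f) (C g) t)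
    ; *-homo = λ a f t → trans (B.cong (C.*-homo a f) t) (B.*-homo a (C f) t)
    }
    where module B = IsLinear B-lin
          module C = IsLinear C-lin

  opaque
    unfolding binomialSum

    binomialSum-homo : ∀ {B} → IsLinear B → ∀ N (g : ℕ → Seq) (w : ℕ → Carrier) →
                       B (λ t → binomialSum N (λ i j → g i t * w j)) ≐
                       λ t → binomialSum N (λ i j → B (g i) t * w j)
    binomialSum-homo B-lin N g w t = trans (B.∑-homo N _ t)
      (∑-cong N (λ {i} _ → trans (B.*-homo _ _ t) (*-congˡ (B.*-homoʳ (w (N ∸ i)) (g i) t))))
      where module B = IsLinear B-lin

  shift^ᵒ : ∀ i f t → (shift ^ᵒ i) f t ≡ f (i ℕ.+ t)
  shift^ᵒ zero    f t = ≡.refl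
  shift^ᵒ (suc i) f t = ≡.trans (shift^ᵒ i f (suc t)) (≡.cong f (ℕₚ.+-suc i t))

  ^ᵒ-cong : ∀ {F G : Endo} → (∀ {f g} → f ≐ g → F f ≐ F g) → (∀ f → F f ≐ G f) →
            ∀ m f → (F ^ᵒ m) f ≐ (G ^ᵒ m) f
  ^ᵒ-cong F-cong F≐G zero    f t = refl
  ^ᵒ-cong F-cong F≐G (suc m) f t = trans (F-cong (^ᵒ-cong F-cong F≐G m f) t) (F≐G _ t)

  +ᵒ-binomial : ∀ {B} → IsLinear B → ∀ a N f →
                ((a +ᵒ B) ^ᵒ N) f ≐ λ t → binomialSum N (λ i j → (B ^ᵒ i) f t * a ^ j)
  +ᵒ-binomial {B} B-lin a zero    f t =
    sym (trans (binomialSum-zero (λ i j → (B ^ᵒ i) f t * a ^ j)) (*-identityʳ _))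
  +ᵒ-binomial {B} B-lin a (suc N) f t = begin
    a * X t + B X t
      ≈⟨ +-cong (*-congˡ (+ᵒ-binomial B-lin a N f t)) (IsLinear.cong B-lin (+ᵒ-binomial B-lin a N f) t) ⟩
    a * binomialSum N (λ i j → (B ^ᵒ i) f t * a ^ j) +
    B (λ t′ → binomialSum N (λ i j → (B ^ᵒ i) f t′ * a ^ j)) t
      ≈⟨ +-cong (*-distribˡ-binomialSum N a (λ i j → (B ^ᵒ i) f t * a ^ j))
                (binomialSum-homo B-lin N (λ i → (B ^ᵒ i) f) (a ^_) t) ⟩
    binomialSum N (λ i j → a * ((B ^ᵒ i) f t * a ^ j)) + binomialSum N (λ i j → (B ^ᵒ suc i) f t * a ^ j)
      ≈⟨ +-congʳ (binomialSum-cong N (λ _ → x∙yz≈y∙zx _ _ _)) ⟩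
    binomialSum N (λ i j → (B ^ᵒ i) f t * a ^ suc j) + binomialSum N (λ i j → (B ^ᵒ suc i) f t * a ^ j)
      ≈⟨ +-comm _ _ ⟩
    binomialSum N (λ i j → (B ^ᵒ suc i) f t * a ^ j) + binomialSum N (λ i j → (B ^ᵒ i) f t * a ^ suc j)
      ≈⟨ binomialSum-pascal N (λ i j → (B ^ᵒ i) f t * a ^ j) ⟨
    binomialSum (suc N) (λ i j → (B ^ᵒ i) f t * a ^ j) ∎
    where
    X : Seq
    X = ((a +ᵒ B) ^ᵒ N) f

  infixl 7 _⊙_
  _⊙_ : FPS2 R → FPS2 R → FPS2 R
  (A ⊙ B) m n = binomialSum m (λ i i′ → binomialSum n (λ j j′ → A i j * B i′ j′))

  binomialSum-⊙ : ∀ (a b : ℕ → Carrier) (G : FPS2 R) m n →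
                  binomialSum n (λ q j → binomialSum m (λ p i → G p q * a i) * b j) ≈
                  ((λ i j → a i * b j) ⊙ G) m n
  binomialSum-⊙ a b G m n = begin
    binomialSum n (λ q j → binomialSum m (λ p i → G p q * a i) * b j)
      ≈⟨ binomialSum-cong n (λ _ → trans (*-comm _ _) (*-distribˡ-binomialSum m _ _)) ⟩
    binomialSum n (λ q j → binomialSum m (λ p i → b j * (G p q * a i)))
      ≈⟨ binomialSum-flip n _ ⟩
    binomialSum n (λ j q → binomialSum m (λ p i → b j * (G p q * a i)))
      ≈⟨ binomialSum-cong n (λ _ → trans (binomialSum-flip m _)
                                          (binomialSum-cong m (λ _ → x∙yz≈zx∙y _ _ _))) ⟩
    binomialSum n (λ j q → binomialSum m (λ i p → a i * b j * G p q))
      ≈⟨ binomialSum-comm m n (λ i p j q → a i * b j * G p q) ⟨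
    binomialSum m (λ i p → binomialSum n (λ j q → a i * b j * G p q)) ∎

  stepSum : Seq → Carrier → FPS2 R
  stepSum f d p q = binomialSum p (λ k l → f (2 ℕ.* k ℕ.+ (l ℕ.+ q)) * d ^ l)

  shift∘-^ᵒ : ∀ a p f t → ((shift ∘′ (a +ᵒ shift)) ^ᵒ p) f t ≈ ((a +ᵒ shift) ^ᵒ p) f (p ℕ.+ t)
  shift∘-^ᵒ a zero    f t = refl
  shift∘-^ᵒ a (suc p) f t = begin
    a * T^p f (suc t) + T^p f (suc (suc t))
      ≈⟨ +-cong (*-congˡ (shift∘-^ᵒ a p f (suc t))) (shift∘-^ᵒ a p f (suc (suc t))) ⟩
    a * Y (p ℕ.+ suc t) + Y (p ℕ.+ suc (suc t))
      ≡⟨ ≡.cong₂ (λ i j → a * Y i + Y j)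
                 (ℕₚ.+-suc p t) (≡.trans (ℕₚ.+-suc p (suc t)) (≡.cong suc (ℕₚ.+-suc p t))) ⟩
    a * Y (suc (p ℕ.+ t)) + Y (suc (suc (p ℕ.+ t))) ∎
    where
    T^p : Endo
    T^p = (shift ∘′ (a +ᵒ shift)) ^ᵒ p
    Y : Seq
    Y = ((a +ᵒ shift) ^ᵒ p) f

  shift∘-^ᵒ-stepSum : ∀ d p f t → ((shift ∘′ (d +ᵒ shift)) ^ᵒ p) f t ≈ stepSum f d p t
  shift∘-^ᵒ-stepSum d p f t = begin
    ((shift ∘′ (d +ᵒ shift)) ^ᵒ p) f t
      ≈⟨ shift∘-^ᵒ d p f t ⟩
    ((d +ᵒ shift) ^ᵒ p) f (p ℕ.+ t)
      ≈⟨ +ᵒ-binomial shift-isLinear d p f (p ℕ.+ t) ⟩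
    binomialSum p (λ k l → (shift ^ᵒ k) f (p ℕ.+ t) * d ^ l)
      ≈⟨ binomialSum-cong p (λ {k} k≤p →
           *-congʳ (reflexive (≡.trans (shift^ᵒ k f (p ℕ.+ t)) (≡.cong f (index k≤p))))) ⟩
    stepSum f d p t ∎
    where
    index : ∀ {k} → k ≤ p → k ℕ.+ (p ℕ.+ t) ≡ 2 ℕ.* k ℕ.+ ((p ∸ k) ℕ.+ t)
    index {k} k≤p = ≡.trans (≡.cong (λ p′ → k ℕ.+ (p′ ℕ.+ t)) (≡.sym (ℕₚ.m+[n∸m]≡n k≤p)))
                            (regroup k (p ∸ k) t)
      where
      regroup : ∀ k l t → k ℕ.+ ((k ℕ.+ l) ℕ.+ t) ≡ 2 ℕ.* k ℕ.+ (l ℕ.+ t)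
      regroup = solve-∀

  module _ (u d : Carrier) (d≈u+u : d ≈ u + u) where

    private
      U T : Endo
      U = u +ᵒ shift
      T = shift ∘′ (d +ᵒ shift)

      U²≐ : ∀ f → (U ^ᵒ 2) f ≐ (u * u +ᵒ T) f
      U²≐ f t = trans (expand u (f t) (f (suc t)) (f (suc (suc t)))) (+-congˡ (+-congʳ (*-congʳ (sym d≈u+u))))
        where
        expand : ∀ u x y z → u * (u * x + y) + (u * y + z) ≈ u * u * x + ((u + u) * y + z)
        expand = solve 4 (λ u x y z → u :* (u :* x :+ y) :+ (u :* y :+ z)
                                    := u :* u :* x :+ ((u :+ u) :* y :+ z)) refl

      U^ᵒ-at-0 : ∀ N f → (U ^ᵒ N) f 0 ≈ binomialSum N (λ i j → f i * u ^ j)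
      U^ᵒ-at-0 N f = trans (+ᵒ-binomial shift-isLinear u N f 0)
        (binomialSum-cong N (λ {i} _ →
          *-congʳ (reflexive (≡.trans (shift^ᵒ i f 0) (≡.cong f (ℕₚ.+-identityʳ i))))))

      U^ᵒ-double : ∀ m f t → (U ^ᵒ (2 ℕ.* m)) f t ≈ binomialSum m (λ p i → stepSum f d p t * (u * u) ^ i)
      U^ᵒ-double m f t = begin
        (U ^ᵒ (2 ℕ.* m)) f t
          ≡⟨ ≡.cong (λ F → F f t)
                    (≡.trans (≡.cong (U ^ᵒ_) (ℕₚ.*-comm 2 m)) (≡.sym (^ᵒ-assoc U m 2))) ⟩
        ((U ^ᵒ 2) ^ᵒ m) f t
          ≈⟨ ^ᵒ-cong (IsLinear.cong U²-isLinear) U²≐ m f t ⟩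
        ((u * u +ᵒ T) ^ᵒ m) f t
          ≈⟨ +ᵒ-binomial T-isLinear (u * u) m f t ⟩
        binomialSum m (λ p i → (T ^ᵒ p) f t * (u * u) ^ i)
          ≈⟨ binomialSum-cong m (λ {p} _ → *-congʳ (shift∘-^ᵒ-stepSum d p f t)) ⟩
        binomialSum m (λ p i → stepSum f d p t * (u * u) ^ i) ∎
        where
        U-isLinear : IsLinear U
        U-isLinear = +ᵒ-isLinear u shift-isLinear
        U²-isLinear : IsLinear (U ∘′ U)
        U²-isLinear = ∘-isLinear U-isLinear U-isLinear
        T-isLinear : IsLinear T
        T-isLinear = ∘-isLinear shift-isLinear (+ᵒ-isLinear d shift-isLinear)

    binomialSum-2m+n : ∀ (s : Seq) m n → binomialSum (2 ℕ.* m ℕ.+ n) (λ i j → s i * u ^ j) ≈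
                       ((λ i j → (u * u) ^ i * u ^ j) ⊙ stepSum s d) m n
    binomialSum-2m+n s m n = begin
      binomialSum (2 ℕ.* m ℕ.+ n) (λ i j → s i * u ^ j)
        ≈⟨ U^ᵒ-at-0 (2 ℕ.* m ℕ.+ n) s ⟨
      (U ^ᵒ (2 ℕ.* m ℕ.+ n)) s 0
        ≡⟨ ≡.cong (λ F → F s 0)
                  (≡.trans (≡.cong (U ^ᵒ_) (ℕₚ.+-comm (2 ℕ.* m) n)) (^ᵒ-homo U n (2 ℕ.* m))) ⟩
      (U ^ᵒ n) ((U ^ᵒ (2 ℕ.* m)) s) 0
        ≈⟨ U^ᵒ-at-0 n _ ⟩
      binomialSum n (λ q j → (U ^ᵒ (2 ℕ.* m)) s q * u ^ j)
        ≈⟨ binomialSum-cong n (λ {q} _ → *-congʳ (U^ᵒ-double m s q)) ⟩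
      binomialSum n (λ q j → binomialSum m (λ p i → stepSum s d p q * (u * u) ^ i) * u ^ j)
        ≈⟨ binomialSum-⊙ ((u * u) ^_) (u ^_) (stepSum s d) m n ⟩
      ((λ i j → (u * u) ^ i * u ^ j) ⊙ stepSum s d) m n ∎

  opaque
    unfolding binomialSum

    Cpoly≈binomialSum : ∀ u α N → Cpoly R u α N ≈ binomialSum N (λ i j → rising R α i * u ^ j)
    Cpoly≈binomialSum u α N = ∑-cong N (λ _ → *-assoc _ _ _)

  fromℕ2*x≈x+x : ∀ x → fromℕ R 2 * x ≈ x + x
  fromℕ2*x≈x+x = solve 1 (λ x → (con 1 :+ (con 1 :+ con 0)) :* x := x :+ x) refl

  x·_ y·_ : FPS2 R → FPS2 R
  (x· f) zero    b = 0#
  (x· f) (suc a) b = f a b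
  (y· f) a zero    = 0#
  (y· f) a (suc b) = f a b

  ⊛-linearS : ∀ p q f a b → _⊛_ R f (linearS R p q) a b ≈ (x· f) a b * p + (y· f) a b * q
  ⊛-linearS p q f a b = outer a
    where
    L : FPS2 R
    L = linearS R p q

    I : ℕ → ℕ → Carrier
    I i r = ∑[ j ≤ b ] (f i j * L r (b ∸ j))

    I-0 : ∀ i n → ∑[ j ≤ n ] (f i j * L 0 (n ∸ j)) ≈ (y· f) i n * q
    I-0 i zero    = trans (zeroʳ _) (sym (zeroˡ q))
    I-0 i (suc n) = trans (∑-antidiagonal-≤1 n (λ j r → f i j * L 0 r) (λ _ _ → zeroʳ _))
                          (trans (+-congˡ (zeroʳ _)) (+-identityʳ _))

    I-1 : ∀ i n → ∑[ j ≤ n ] (f i j * L 1 (n ∸ j)) ≈ f i n * p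
    I-1 i zero    = refl
    I-1 i (suc n) = trans (∑-antidiagonal-≤1 n (λ j r → f i j * L 1 r) (λ _ _ → zeroʳ _))
                          (trans (+-congʳ (zeroʳ _)) (+-identityˡ _))

    I-≥2 : ∀ i r → I i (suc (suc r)) ≈ 0#
    I-≥2 i r = ∑-0 b (λ _ → zeroʳ _)

    outer : ∀ a → ∑[ i ≤ a ] I i (a ∸ i) ≈ (x· f) a b * p + (y· f) a b * q
    outer zero    = trans (I-0 0 b) (sym (trans (+-congʳ (zeroˡ p)) (+-identityˡ _)))
    outer (suc a) = trans (∑-antidiagonal-≤1 a I I-≥2) (+-cong (I-1 a b) (I-0 (suc a) b))

  module _ (p q : Carrier) where

    powS-linearS-< : ∀ J a b → J < a ℕ.+ b → powS R (linearS R p q) J a b ≈ 0#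
    powS-linearS-< zero    zero    zero    ()
    powS-linearS-< zero    zero    (suc b) _ = refl
    powS-linearS-< zero    (suc a) b       _ = refl
    powS-linearS-< (suc J) a       b       J<a+b =
      trans (⊛-linearS p q _ a b) (trans (+-cong (x-part a J<a+b) (y-part b J<a+b)) (+-identityʳ 0#))
      where
      P : FPS2 R
      P = powS R (linearS R p q) J
      x-part : ∀ a → suc J < a ℕ.+ b → (x· P) a b * p ≈ 0#
      x-part zero    _           = zeroˡ p
      x-part (suc a) (s≤s J<a+b) = trans (*-congʳ (powS-linearS-< J a b J<a+b)) (zeroˡ p)
      y-part : ∀ b → suc J < a ℕ.+ b → (y· P) a b * q ≈ 0#
      y-part zero    _     = zeroˡ q
      y-part (suc b) J<a+b = trans (*-congʳ (powS-linearS-< J a b J<a+b′)) (zeroˡ q)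
        where
        J<a+b′ : J < a ℕ.+ b
        J<a+b′ = ℕₚ.≤-pred (≡.subst (suc (suc J) ≤_) (ℕₚ.+-suc a b) J<a+b)

    powS-linearS-diagonal : ∀ J a b → a ℕ.+ b ≡ J →
                            powS R (linearS R p q) J a b ≈ fromℕ R (J C a) * (p ^ a * q ^ b)
    powS-linearS-diagonal zero    zero zero ≡.refl =
      sym (trans (*-cong (+-identityʳ 1#) (*-identityˡ 1#)) (*-identityˡ 1#))
    powS-linearS-diagonal (suc J) a    b    a+b≡1+J = trans (⊛-linearS p q _ a b) (step a b a+b≡1+J)
      where
      P : FPS2 R
      P = powS R (linearS R p q) J

      nCn≡[n+1]C[n+1] : ∀ {a J} → a ≡ J → J C a ≡ suc J C suc a
      nCn≡[n+1]C[n+1] {a} ≡.refl = ≡.trans (nCn≡1 a) (≡.sym (nCn≡1 (suc a)))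

      step : ∀ a b → a ℕ.+ b ≡ suc J →
             (x· P) a b * p + (y· P) a b * q ≈ fromℕ R (suc J C a) * (p ^ a * q ^ b)
      step zero (suc b) e = begin
        0# * p + P 0 b * q
          ≈⟨ +-cong (zeroˡ p) (*-congʳ (powS-linearS-diagonal J 0 b (ℕₚ.suc-injective e))) ⟩
        0# + fromℕ R 1 * (1# * q ^ b) * q
          ≈⟨ +-identityˡ _ ⟩
        fromℕ R 1 * (1# * q ^ b) * q
          ≈⟨ trans (*-assoc _ _ _) (*-congˡ (*-assoc _ _ _)) ⟩
        fromℕ R 1 * (1# * (q ^ b * q)) ∎
      step (suc a) zero e = begin
        P a 0 * p + 0# * q
          ≈⟨ +-cong (*-congʳ (powS-linearS-diagonal J a 0 a+0≡J)) (zeroˡ q) ⟩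
        fromℕ R (J C a) * (p ^ a * 1#) * p + 0#
          ≈⟨ +-identityʳ _ ⟩
        fromℕ R (J C a) * (p ^ a * 1#) * p
          ≈⟨ regroup _ _ _ _ ⟩
        fromℕ R (J C a) * (p ^ a * p * 1#)
          ≡⟨ ≡.cong (λ k → fromℕ R k * (p ^ a * p * 1#)) (nCn≡[n+1]C[n+1] a≡J) ⟩
        fromℕ R (suc J C suc a) * (p ^ a * p * 1#) ∎
        where
        a+0≡J : a ℕ.+ 0 ≡ J
        a+0≡J = ℕₚ.suc-injective e
        a≡J : a ≡ J
        a≡J = ≡.trans (≡.sym (ℕₚ.+-identityʳ a)) a+0≡J
        regroup : ∀ c x o y → c * (x * o) * y ≈ c * (x * y * o)
        regroup = solve 4 (λ c x o y → c :* (x :* o) :* y := c :* (x :* y :* o)) refl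
      step (suc a) (suc b) e = begin
        P a (suc b) * p + P (suc a) b * q
          ≈⟨ +-cong (*-congʳ (powS-linearS-diagonal J a (suc b) (ℕₚ.suc-injective e)))
                    (*-congʳ (powS-linearS-diagonal J (suc a) b
                               (≡.trans (≡.sym (ℕₚ.+-suc a b)) (ℕₚ.suc-injective e)))) ⟩
        fromℕ R (J C a) * (p ^ a * (q ^ b * q)) * p + fromℕ R (J C suc a) * (p ^ a * p * q ^ b) * q
          ≈⟨ regroup _ _ _ _ _ _ ⟩
        (fromℕ R (J C a) + fromℕ R (J C suc a)) * (p ^ a * p * (q ^ b * q))
          ≈⟨ *-congʳ (fromℕ-pascal J a) ⟨
        fromℕ R (suc J C suc a) * (p ^ a * p * (q ^ b * q)) ∎
        where
        regroup : ∀ c₁ c₂ x y p q →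
                  c₁ * (x * (y * q)) * p + c₂ * (x * p * y) * q ≈ (c₁ + c₂) * (x * p * (y * q))
        regroup = solve 6 (λ c₁ c₂ x y p q → c₁ :* (x :* (y :* q)) :* p :+ c₂ :* (x :* p :* y) :* q
                                          := (c₁ :+ c₂) :* (x :* p :* (y :* q))) refl

    ∑-powS-linearS : ∀ (w : ℕ → Carrier) a b →
                     ∑[ j ≤ a ℕ.+ b ] (w j * powS R (linearS R p q) j a b) ≈
                     w (a ℕ.+ b) * (fromℕ R ((a ℕ.+ b) C a) * (p ^ a * q ^ b))
    ∑-powS-linearS w a b =
      trans (∑-last (a ℕ.+ b) (λ {j} j<a+b → trans (*-congˡ (powS-linearS-< j a b j<a+b)) (zeroʳ _)))
            (*-congˡ (powS-linearS-diagonal (a ℕ.+ b) a b ≡.refl))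

  ⊛-cong : ∀ {f f′ g g′ : FPS2 R} → (∀ a b → f a b ≈ f′ a b) → (∀ a b → g a b ≈ g′ a b) →
           ∀ m n → _⊛_ R f g m n ≈ _⊛_ R f′ g′ m n
  ⊛-cong f≈f′ g≈g′ m n = ∑-cong m (λ _ → ∑-cong n (λ _ → *-cong (f≈f′ _ _) (g≈g′ _ _)))

  module Factorials (inv : ℕ → Carrier) (inv-correct : ∀ n → fromℕ R (suc n) * inv n ≈ 1#) where

    infix 10 _!⁻¹
    _!⁻¹ : ℕ → Carrier
    _!⁻¹ = invFact R inv

    !⁻¹-inverse : ∀ k → k !⁻¹ * fromℕ R (k !) ≈ 1#
    !⁻¹-inverse zero    = trans (*-identityˡ _) (+-identityʳ 1#)
    !⁻¹-inverse (suc k) = begin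
      k !⁻¹ * inv k * fromℕ R (suc k ℕ.* k !)
        ≈⟨ *-congˡ (trans (fromℕ-homo-* (suc k) (k !)) (*-comm _ _)) ⟩
      k !⁻¹ * inv k * (fromℕ R (k !) * fromℕ R (suc k))
        ≈⟨ *-interchange _ _ _ _ ⟩
      k !⁻¹ * fromℕ R (k !) * (inv k * fromℕ R (suc k))
        ≈⟨ *-cong (!⁻¹-inverse k) (trans (*-comm _ _) (inv-correct k)) ⟩
      1# * 1#
        ≈⟨ *-identityˡ 1# ⟩
      1# ∎

    !⁻¹-binomial : ∀ {N k} → k ≤ N → N !⁻¹ * fromℕ R (N C k) ≈ k !⁻¹ * (N ∸ k) !⁻¹
    !⁻¹-binomial {N} {k} k≤N = begin
      N !⁻¹ * binom
        ≈⟨ *-identityʳ _ ⟨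
      N !⁻¹ * binom * 1#
        ≈⟨ *-congˡ (trans (*-cong (!⁻¹-inverse k) (!⁻¹-inverse (N ∸ k))) (*-identityˡ 1#)) ⟨
      N !⁻¹ * binom * (k !⁻¹ * k!ᴿ * ((N ∸ k) !⁻¹ * [N∸k]!ᴿ))
        ≈⟨ regroup _ _ _ _ _ _ ⟩
      N !⁻¹ * (binom * (k!ᴿ * [N∸k]!ᴿ)) * (k !⁻¹ * (N ∸ k) !⁻¹)
        ≈⟨ *-congʳ (*-congˡ (trans (*-congˡ (sym (fromℕ-homo-* (k !) ((N ∸ k) !))))
                                   (sym (fromℕ-homo-* (N C k) _)))) ⟩
      N !⁻¹ * fromℕ R ((N C k) ℕ.* (k ! ℕ.* (N ∸ k) !)) * (k !⁻¹ * (N ∸ k) !⁻¹)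
        ≡⟨ ≡.cong (λ n → N !⁻¹ * fromℕ R n * (k !⁻¹ * (N ∸ k) !⁻¹)) (nCk*[k!*[n∸k]!]≡n! k≤N) ⟩
      N !⁻¹ * fromℕ R (N !) * (k !⁻¹ * (N ∸ k) !⁻¹)
        ≈⟨ trans (*-congʳ (!⁻¹-inverse N)) (*-identityˡ _) ⟩
      k !⁻¹ * (N ∸ k) !⁻¹ ∎
      where
      binom k!ᴿ [N∸k]!ᴿ : Carrier
      binom = fromℕ R (N C k)
      k!ᴿ = fromℕ R (k !)
      [N∸k]!ᴿ = fromℕ R ((N ∸ k) !)
      regroup : ∀ n c i k j l → n * c * (i * k * (j * l)) ≈ n * (c * (k * l)) * (i * j)
      regroup = solve 6 (λ n c i k j l → n :* c :* (i :* k :* (j :* l)) := n :* (c :* (k :* l)) :* (i :* j)) refl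

    !⁻¹-binomial-+ : ∀ a b → (a ℕ.+ b) !⁻¹ * fromℕ R ((a ℕ.+ b) C a) ≈ a !⁻¹ * b !⁻¹
    !⁻¹-binomial-+ a b =
      trans (!⁻¹-binomial (ℕₚ.m≤m+n a b)) (*-congˡ (reflexive (≡.cong _!⁻¹ (ℕₚ.m+n∸m≡n a b))))

    opaque
      unfolding binomialSum

      ∑-!⁻¹ : ∀ N h → ∑[ i ≤ N ] (i !⁻¹ * (N ∸ i) !⁻¹ * h i (N ∸ i)) ≈ N !⁻¹ * binomialSum N h
      ∑-!⁻¹ N h = begin
        ∑[ i ≤ N ] (i !⁻¹ * (N ∸ i) !⁻¹ * h i (N ∸ i))
          ≈⟨ ∑-cong N (λ i≤N → trans (sym (*-assoc _ _ _)) (*-congʳ (!⁻¹-binomial i≤N))) ⟨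
        ∑[ i ≤ N ] (N !⁻¹ * (fromℕ R (N C i) * h i (N ∸ i)))
          ≈⟨ *-distribˡ-∑ N _ _ ⟨
        N !⁻¹ * binomialSum N h ∎

    egf : FPS2 R → FPS2 R
    egf A m n = m !⁻¹ * n !⁻¹ * A m n

    egf-⊛ : ∀ A B m n → _⊛_ R (egf A) (egf B) m n ≈ egf (A ⊙ B) m n
    egf-⊛ A B m n = begin
      ∑[ i ≤ m ] (∑[ j ≤ n ] (egf A i j * egf B (m ∸ i) (n ∸ j)))
        ≈⟨ ∑-cong m (λ _ → trans (∑-cong n (λ _ → regroup _ _ _ _ _ _)) (sym (*-distribˡ-∑ n _ _))) ⟩
      ∑[ i ≤ m ] (i !⁻¹ * (m ∸ i) !⁻¹ * ∑[ j ≤ n ] (j !⁻¹ * (n ∸ j) !⁻¹ * (A i j * B (m ∸ i) (n ∸ j))))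
        ≈⟨ ∑-cong m (λ {i} _ → *-congˡ (∑-!⁻¹ n (λ j j′ → A i j * B (m ∸ i) j′))) ⟩
      ∑[ i ≤ m ] (i !⁻¹ * (m ∸ i) !⁻¹ * (n !⁻¹ * binomialSum n (λ j j′ → A i j * B (m ∸ i) j′)))
        ≈⟨ ∑-!⁻¹ m (λ i i′ → n !⁻¹ * binomialSum n (λ j j′ → A i j * B i′ j′)) ⟩
      m !⁻¹ * binomialSum m (λ i i′ → n !⁻¹ * binomialSum n (λ j j′ → A i j * B i′ j′))
        ≈⟨ *-congˡ (*-distribˡ-binomialSum m (n !⁻¹) _) ⟨
      m !⁻¹ * (n !⁻¹ * (A ⊙ B) m n)
        ≈⟨ *-assoc _ _ _ ⟨
      egf (A ⊙ B) m n ∎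
      where
      regroup : ∀ a c x b d y → a * c * x * (b * d * y) ≈ a * b * (c * d * (x * y))
      regroup = solve 6 (λ a c x b d y → a :* c :* x :* (b :* d :* y) := a :* b :* (c :* d :* (x :* y))) refl

    ∑-egf-powS-linearS : ∀ p q (w : ℕ → Carrier) a b →
                         ∑[ j ≤ a ℕ.+ b ] (w j * j !⁻¹ * powS R (linearS R p q) j a b) ≈
                         egf (λ a b → w (a ℕ.+ b) * (p ^ a * q ^ b)) a b
    ∑-egf-powS-linearS p q w a b = begin
      ∑[ j ≤ a ℕ.+ b ] (w j * j !⁻¹ * powS R (linearS R p q) j a b)
        ≈⟨ ∑-powS-linearS p q (λ j → w j * j !⁻¹) a b ⟩
      w (a ℕ.+ b) * (a ℕ.+ b) !⁻¹ * (fromℕ R ((a ℕ.+ b) C a) * (p ^ a * q ^ b))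
        ≈⟨ regroup _ _ _ _ ⟩
      (a ℕ.+ b) !⁻¹ * fromℕ R ((a ℕ.+ b) C a) * (w (a ℕ.+ b) * (p ^ a * q ^ b))
        ≈⟨ *-congʳ (!⁻¹-binomial-+ a b) ⟩
      egf (λ a b → w (a ℕ.+ b) * (p ^ a * q ^ b)) a b ∎
      where
      regroup : ∀ w i c x → w * i * (c * x) ≈ i * c * (w * x)
      regroup = solve 4 (λ w i c x → w :* i :* (c :* x) := i :* c :* (w :* x)) refl

    expS-linearS : ∀ p q a b → expS R inv (linearS R p q) a b ≈ egf (λ a b → p ^ a * q ^ b) a b
    expS-linearS p q a b = begin
      ∑[ j ≤ a ℕ.+ b ] (j !⁻¹ * powS R (linearS R p q) j a b)
        ≈⟨ ∑-cong (a ℕ.+ b) (λ _ → *-congʳ (*-identityˡ _)) ⟨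
      ∑[ j ≤ a ℕ.+ b ] (1# * j !⁻¹ * powS R (linearS R p q) j a b)
        ≈⟨ ∑-egf-powS-linearS p q (λ _ → 1#) a b ⟩
      egf (λ a b → 1# * (p ^ a * q ^ b)) a b
        ≈⟨ *-congˡ (*-identityˡ _) ⟩
      egf (λ a b → p ^ a * q ^ b) a b ∎

    binomS-linearS : ∀ γ p q a b → binomS R inv γ (linearS R p q) a b ≈
                                   egf (λ a b → falling R γ (a ℕ.+ b) * (p ^ a * q ^ b)) a b
    binomS-linearS γ p q = ∑-egf-powS-linearS p q (falling R γ)

    binomS-neg-linearS : ∀ β d a b → binomS R inv (- β) (linearS R (- d) (- 1#)) a b ≈
                                     egf (λ a b → rising R β (a ℕ.+ b) * d ^ a) a b
    binomS-neg-linearS β d a b = trans (binomS-linearS (- β) (- d) (- 1#) a b) (*-congˡ (begin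
      falling R (- β) (a ℕ.+ b) * ((- d) ^ a * (- 1#) ^ b)
        ≈⟨ *-congˡ (*-congʳ (-‿^ d a)) ⟩
      falling R (- β) (a ℕ.+ b) * ((- 1#) ^ a * d ^ a * (- 1#) ^ b)
        ≈⟨ regroup _ _ _ _ ⟩
      falling R (- β) (a ℕ.+ b) * ((- 1#) ^ a * (- 1#) ^ b) * d ^ a
        ≈⟨ *-congʳ (*-congˡ (^-homo-* (- 1#) a b)) ⟨
      falling R (- β) (a ℕ.+ b) * (- 1#) ^ (a ℕ.+ b) * d ^ a
        ≈⟨ *-congʳ (falling-neg β (a ℕ.+ b)) ⟩
      rising R β (a ℕ.+ b) * d ^ a ∎))
      where
      regroup : ∀ f x y z → f * (x * y * z) ≈ f * (x * z) * y
      regroup = solve 4 (λ f x y z → f :* (x :* y :* z) := f :* (x :* z) :* y) refl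

    sumXk-binomS : ∀ α d p q →
      sumXk R (λ k → scaleS R (rising R α (2 ℕ.* k) * k !⁻¹)
                              (binomS R inv (- (fromℕ R (2 ℕ.* k) + α)) (linearS R (- d) (- 1#)))) p q
        ≈ egf (stepSum (rising R α) d) p q
    sumXk-binomS α d p q = begin
      ∑[ k ≤ p ] (rising R α (2 ℕ.* k) * k !⁻¹ * binomS R inv (- β k) (linearS R (- d) (- 1#)) (p ∸ k) q)
        ≈⟨ ∑-cong p (λ {k} _ → term k (p ∸ k)) ⟩
      ∑[ k ≤ p ] (k !⁻¹ * (p ∸ k) !⁻¹ * (q !⁻¹ * (rising R α (2 ℕ.* k ℕ.+ ((p ∸ k) ℕ.+ q)) * d ^ (p ∸ k))))
        ≈⟨ ∑-!⁻¹ p (λ k l → q !⁻¹ * (rising R α (2 ℕ.* k ℕ.+ (l ℕ.+ q)) * d ^ l)) ⟩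
      p !⁻¹ * binomialSum p (λ k l → q !⁻¹ * (rising R α (2 ℕ.* k ℕ.+ (l ℕ.+ q)) * d ^ l))
        ≈⟨ *-congˡ (*-distribˡ-binomialSum p (q !⁻¹) _) ⟨
      p !⁻¹ * (q !⁻¹ * stepSum (rising R α) d p q)
        ≈⟨ *-assoc _ _ _ ⟨
      egf (stepSum (rising R α) d) p q ∎
      where
      β : ℕ → Carrier
      β k = fromℕ R (2 ℕ.* k) + α

      regroup : ∀ ρ k l q r δ → ρ * k * (l * q * (r * δ)) ≈ k * l * (q * (ρ * r * δ))
      regroup = solve 6 (λ ρ k l q r δ → ρ :* k :* (l :* q :* (r :* δ)) := k :* l :* (q :* (ρ :* r :* δ))) refl

      term : ∀ k l → rising R α (2 ℕ.* k) * k !⁻¹ * binomS R inv (- β k) (linearS R (- d) (- 1#)) l q ≈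
                     k !⁻¹ * l !⁻¹ * (q !⁻¹ * (rising R α (2 ℕ.* k ℕ.+ (l ℕ.+ q)) * d ^ l))
      term k l = begin
        rising R α (2 ℕ.* k) * k !⁻¹ * binomS R inv (- β k) (linearS R (- d) (- 1#)) l q
          ≈⟨ *-congˡ (binomS-neg-linearS (β k) d l q) ⟩
        rising R α (2 ℕ.* k) * k !⁻¹ * (l !⁻¹ * q !⁻¹ * (rising R (β k) (l ℕ.+ q) * d ^ l))
          ≈⟨ regroup _ _ _ _ _ _ ⟩
        k !⁻¹ * l !⁻¹ * (q !⁻¹ * (rising R α (2 ℕ.* k) * rising R (β k) (l ℕ.+ q) * d ^ l))
          ≈⟨ *-congˡ (*-congˡ (*-congʳ (rising-+ α (2 ℕ.* k) (l ℕ.+ q)))) ⟩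
        k !⁻¹ * l !⁻¹ * (q !⁻¹ * (rising R α (2 ℕ.* k ℕ.+ (l ℕ.+ q)) * d ^ l)) ∎

theorem3p3 : ∀ {c ℓ} (R : CommutativeRing c ℓ)
               (inv : ℕ → CommutativeRing.Carrier R) →
               (∀ n → CommutativeRing._≈_ R (CommutativeRing._*_ R (fromℕ R (suc n)) (inv n)) (CommutativeRing.1# R)) →
               (u α : CommutativeRing.Carrier R) →
               ∀ m n → CommutativeRing._≈_ R (LHS R inv u α m n) (RHS R inv u α m n)
theorem3p3 R inv inv-correct u α m n = begin
  LHS R inv u α m n
    ≈⟨ trans (*-assoc _ _ _) (*-comm _ _) ⟩
  egf (λ m n → Cpoly R u α (2 ℕ.* m ℕ.+ n)) m n
    ≈⟨ *-congˡ (trans (Cpoly≈binomialSum u α _)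
                      (binomialSum-2m+n u d (fromℕ2*x≈x+x u) (rising R α) m n)) ⟩
  egf (E ⊙ stepSum (rising R α) d) m n
    ≈⟨ egf-⊛ E (stepSum (rising R α) d) m n ⟨
  _⊛_ R (egf E) (egf (stepSum (rising R α) d)) m n
    ≈⟨ ⊛-cong (expS-linearS (u * u) u) (sumXk-binomS α d) m n ⟨
  RHS R inv u α m n ∎
  where
  open CommutativeRing R
  open PowerSeries R
  open Factorials inv inv-correct
  open ≈-Reasoning setoid

  d : Carrier
  d = fromℕ R 2 * u

  E : FPS2 R
  E i j = (u * u) ^ i * u ^ j
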